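{- Let $n \ge 7$ and let $C_n(1,3)$ be the graph with vertex set $\{v_0,\dots,v_{n-1}\}$ and edge set $\{v_iv_{i+1} : 0\le i\le n-1\}\cup\{v_iv_{i+3} : 0\le i\le n-1\}$, indices taken modulo $n$. Then the total chromatic number satisfies $\chi''(C_n(1,3)) = 6$ for $n \in \{7,8,12,13,17\}$, and $\chi''(C_n(1,3)) = 5$ for all other $n \ge 7$.
   Context: A total $k$-colouring of a simple graph $G$ is a map $\sigma: V(G)\cup E(G)\to\{1,\dots,k\}$ such that adjacent vertices receive distinct colours, adjacent (i.e. sharing an endpoint) edges receive distinct colours, and each vertex receives a colour different from the colours of its incident edges. The total chromatic number $\chi''(G)$ is the least $k$ for which a total $k$-colouring exists. $C_n(1,3)$ is a $4$-regular circulant graph. -}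

module Defs where

open import Data.Nat using (ℕ; zero; suc; _+_; _≤_)
open import Data.Nat.DivMod using (_%_)
open import Data.Fin using (Fin; toℕ)
open import Data.Sum using (_⊎_)
open import Data.Product using (_×_)
open import Relation.Binary.PropositionalEquality using (_≡_; _≢_)

Jump : (n : ℕ) → Fin n → Fin n → Set
Jump zero ()
Jump (suc m) u v =
  toℕ v ≡ (toℕ u + 1) % suc m ⊎ toℕ v ≡ (toℕ u + 3) % suc m

Adj : (n : ℕ) → Fin n → Fin n → Set
Adj n u v = Jump n u v ⊎ Jump n v u

-- The edge colouring is given as a
-- function on ordered pairs, required to be symmetric on edges, so that it
-- determines a colour for each (unordered) edge uv; values at non-edges are
-- irrelevant.
record TotalColouring (n k : ℕ) : Set where
  field
    vcol : Fin n → Fin k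
    ecol : Fin n → Fin n → Fin k
    ecol-sym : ∀ u v → Adj n u v → ecol u v ≡ ecol v u
    vertex-proper : ∀ u v → Adj n u v → vcol u ≢ vcol v
    edge-proper : ∀ u v w → Adj n u v → Adj n u w → v ≢ w → ecol u v ≢ ecol u w
    incidence-proper : ∀ u v → Adj n u v → vcol u ≢ ecol u v

TotalChromaticNumber : (n k : ℕ) → Set
TotalChromaticNumber n k =
  TotalColouring n k × (∀ j → TotalColouring n j → k ≤ j)

Exceptional : ℕ → Set
Exceptional n = n ≡ 7 ⊎ n ≡ 8 ⊎ n ≡ 12 ⊎ n ≡ 13 ⊎ n ≡ 17

{-# OPTIONS --safe #-}
module Submission where

-- A total colouring of C_n(1,3) is an n-periodic sequence of symbols (colour of v_i, of
-- v_i v_{i+1}, of v_i v_{i+3}) in which every four consecutive symbols satisfy a local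
-- condition, essentially that the vertex v_{i+3} and its four edges get five distinct colours.
-- Hence five colours are always needed, and colourings are closed walks in the automaton whose
-- states are three consecutive symbols. With five colours one state carries closed walks of
-- lengths 5, 14, 16, 18 and 22, which add up to every n ≥ 14 except 17; n = 9 and 11 have
-- separate closed walks, and with six colours closed walks of lengths 7 and 8 plus the one
-- of length 5 give n = 7, 8, 12, 13, 17.
-- Conversely, a 5-colouring with n ∈ {7, 8, 12, 13, 17} gives a closed walk of length n in
-- the finite automaton of 7-tuples of colours that the windows still constrain. Up to
-- recolouring, every walk enters a certain set S of states within 16 steps; rotating the
-- colouring to start there, a meet-in-the-middle search (f steps forward, n - f backward, from
-- each normalised state of S) shows that no closed walk of length n passes through S.

open import Data.Bool using (Bool)
import Data.Bool.Properties as Bool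
open import Data.Empty using (⊥-elim)
open import Data.Fin using (Fin; toℕ; zero; suc)
open import Data.Fin.Patterns using (0F; 1F; 2F; 3F; 4F; 5F)
open import Data.Fin.Permutation using (Permutation′; _⟨$⟩ʳ_; _∘ₚ_; transpose)
import Data.Fin.Permutation as Permutation
open import Data.Fin.Properties using (toℕ-injective; toℕ<n; toℕ-fromℕ<; injective⇒≤)
import Data.Fin.Properties as Fin
open import Data.List using (List; []; _∷_; _++_; length; map; concatMap; filter; foldr; allFin)
open import Data.List.Membership.Propositional using (_∈_; lose)
open import Data.List.Membership.Propositional.Properties
  using (∈-map⁺; ∈-++⁺ˡ; ∈-++⁺ʳ; ∈-concatMap⁺; ∈-filter⁺; ∈-allFin)
open import Data.List.Properties using (length-++)
import Data.List.Properties as List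
import Data.List.Relation.Unary.All as ListAll
open import Data.List.Relation.Unary.Any using (here; there; any?)
open import Data.List.Relation.Unary.Any.Properties using (¬Any[])
open import Data.Nat
  using (ℕ; zero; suc; _+_; _*_; _∸_; _<_; _≤_; z<s; s≤s; z≤n; NonZero; >-nonZero; _<?_)
open import Data.Nat.DivMod
open import Data.Nat.Properties
open import Algebra.Properties.CommutativeSemigroup +-commutativeSemigroup using (x∙yz≈y∙xz)
open import Data.Product using (∃; Σ-syntax; _×_; _,_; proj₁; proj₂; uncurry)
open import Data.Sum using (_⊎_; inj₁; inj₂; [_,_]′)
open import Data.Unit using (tt)
open import Data.Vec using (Vec; []; _∷_; lookup; replicate; updateAt)
import Data.Vec as Vec
open import Data.Vec.Properties using (lookup∘updateAt; lookup∘updateAt′; lookup-replicate)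
open import Data.Vec.Relation.Unary.All using ([]; _∷_; All; all?)
open import Data.Vec.Relation.Unary.All.Properties using (lookup⁺)
open import Data.Vec.Relation.Unary.AllPairs using ([]; _∷_; allPairs?)
open import Data.Vec.Relation.Unary.Unique.Propositional using (Unique)
open import Data.Vec.Relation.Unary.Unique.Propositional.Properties using (map⁺; lookup-injective)
open import Function using (id; _∘_; Injective)
open import Function.Bundles using (Injection)
open import Function.Properties.Inverse using (↔⇒↣)
open import Relation.Binary.Definitions using (tri<; tri≈; tri>)
open import Relation.Binary.PropositionalEquality
open import Relation.Nullary using (Dec; yes; no; does; ¬_; ¬?; _×-dec_)
open import Relation.Nullary.Decidable
  using (True; False; map′; from-yes; toWitness; toWitnessFalse; dec-true; dec-false)
open import Relation.Unary using (Pred; Decidable)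
open import Relation.Unary.Properties using (U?)
open import Defs

open ≡-Reasoning

[m%n+k]%n≡[m+k]%n : ∀ m k n .{{_ : NonZero n}} → (m % n + k) % n ≡ (m + k) % n
[m%n+k]%n≡[m+k]%n m k n = begin
  (m % n + k) % n          ≡⟨ %-distribˡ-+ (m % n) k n ⟩
  (m % n % n + k % n) % n  ≡⟨ cong (λ r → (r + k % n) % n) (m%n%n≡m%n m n) ⟩
  (m % n + k % n) % n      ≡⟨ %-distribˡ-+ m k n ⟨
  (m + k) % n              ∎

m%n≢[m+k]%n : ∀ m k n .{{_ : NonZero n}} → 0 < k → k < n → m % n ≢ (m + k) % n
m%n≢[m+k]%n m k n 0<k k<n eq =
  r≢[r+k]%n (m%n<n m n) (trans eq (sym ([m%n+k]%n≡[m+k]%n m k n)))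
  where
  r≢[r+k]%n : ∀ {r} → r < n → r ≢ (r + k) % n
  r≢[r+k]%n {r} r<n eq with r + k <? n
  ... | yes r+k<n = <⇒≢ (m<m+n r 0<k) (trans eq (m<n⇒m%n≡m r+k<n))
  ... | no r+k≮n with t , n+t≡r+k ← m≤n⇒∃[o]m+o≡n (≮⇒≥ r+k≮n) =
    <⇒≢ t<r (sym (trans eq [r+k]%n≡t))
    where
    t<r : t < r
    t<r = +-cancelˡ-< n t r (subst (_< n + r) (sym n+t≡r+k)
            (subst (r + k <_) (+-comm r n) (+-monoʳ-< r k<n)))
    [r+k]%n≡t : (r + k) % n ≡ t
    [r+k]%n≡t = begin
      (r + k) % n  ≡⟨ cong (_% n) (trans (sym n+t≡r+k) (+-comm n t)) ⟩
      (t + n) % n  ≡⟨ [m+n]%n≡m%n t n ⟩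
      t % n        ≡⟨ m<n⇒m%n≡m (<-trans t<r r<n) ⟩
      t            ∎

[m+d]%n≢[m+e]%n : ∀ m {d e} n .{{_ : NonZero n}} → d < e → e < n → (m + d) % n ≢ (m + e) % n
[m+d]%n≢[m+e]%n m {d} {e} n d<e e<n =
  subst (λ x → (m + d) % n ≢ x % n) m+d+[e∸d]≡m+e
    (m%n≢[m+k]%n (m + d) (e ∸ d) n (m<n⇒0<n∸m d<e) (≤-<-trans (m∸n≤m e d) e<n))
  where
  m+d+[e∸d]≡m+e : m + d + (e ∸ d) ≡ m + e
  m+d+[e∸d]≡m+e = trans (+-assoc m d (e ∸ d)) (cong (m +_) (m+[n∸m]≡n (<⇒≤ d<e)))

[m+d]%n≡[m+e]%n⇒d≡e : ∀ m {d e} n .{{_ : NonZero n}} → d < n → e < n →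
                      (m + d) % n ≡ (m + e) % n → d ≡ e
[m+d]%n≡[m+e]%n⇒d≡e m {d} {e} n d<n e<n eq with <-cmp d e
... | tri< d<e _ _ = ⊥-elim ([m+d]%n≢[m+e]%n m n d<e e<n eq)
... | tri≈ _ d≡e _ = d≡e
... | tri> _ _ e<d = ⊥-elim ([m+d]%n≢[m+e]%n m n e<d d<n (sym eq))

Periodic : {A : Set} → ℕ → (ℕ → A) → Set
Periodic n f = ∀ i → f (n + i) ≡ f i

module _ {A : Set} {n : ℕ} {f : ℕ → A} (periodic : Periodic n f) where

  periodic-*+ : ∀ q i → f (q * n + i) ≡ f i
  periodic-*+ zero    i = refl
  periodic-*+ (suc q) i =
    trans (cong f (+-assoc n (q * n) i)) (trans (periodic _) (periodic-*+ q i))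

  module _ .{{_ : NonZero n}} where

    periodic-% : ∀ i → f (i % n) ≡ f i
    periodic-% i = sym (begin
      f i                    ≡⟨ cong f (m≡m%n+[m/n]*n i n) ⟩
      f (i % n + i / n * n)  ≡⟨ cong f (+-comm (i % n) _) ⟩
      f (i / n * n + i % n)  ≡⟨ periodic-*+ (i / n) (i % n) ⟩
      f (i % n)              ∎)

    periodic-%+ : ∀ i j → f (i % n + j) ≡ f (i + j)
    periodic-%+ i j = begin
      f (i % n + j)          ≡⟨ periodic-% (i % n + j) ⟨
      f ((i % n + j) % n)    ≡⟨ cong f ([m%n+k]%n≡[m+k]%n i j n) ⟩
      f ((i + j) % n)        ≡⟨ periodic-% (i + j) ⟩
      f (i + j)              ∎

transpose-maps : ∀ {k} (i j : Fin k) → transpose i j ⟨$⟩ʳ i ≡ j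
transpose-maps i j rewrite dec-true (i Fin.≟ i) refl = refl

transpose-fixes : ∀ {k} {i j x : Fin k} → x ≢ i → x ≢ j → transpose i j ⟨$⟩ʳ x ≡ x
transpose-fixes {i = i} {j} {x} x≢i x≢j
  rewrite dec-false (x Fin.≟ i) x≢i | dec-false (x Fin.≟ j) x≢j = refl

permutation-mapping : ∀ {k m} (xs ys : Vec (Fin k) m) → Unique xs → Unique ys →
                      ∃ λ (π : Permutation′ k) → ∀ i → π ⟨$⟩ʳ lookup xs i ≡ lookup ys i
permutation-mapping []       []       _             _             = Permutation.id , λ ()
permutation-mapping (x ∷ xs) (y ∷ ys) (x∉xs ∷ !xs) (y∉ys ∷ !ys)
  with π , π-maps ← permutation-mapping xs ys !xs !ys = π ∘ₚ transpose (π ⟨$⟩ʳ x) y , maps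
  where
  maps : ∀ i → transpose (π ⟨$⟩ʳ x) y ⟨$⟩ʳ (π ⟨$⟩ʳ lookup (x ∷ xs) i) ≡ lookup (y ∷ ys) i
  maps zero    = transpose-maps (π ⟨$⟩ʳ x) y
  maps (suc i) = trans (cong (transpose (π ⟨$⟩ʳ x) y ⟨$⟩ʳ_) (π-maps i)) (transpose-fixes
    (λ eq → lookup⁺ x∉xs i (sym (Injection.injective (↔⇒↣ π) (trans (π-maps i) eq))))
    (lookup⁺ y∉ys i ∘ sym))

data Trie (k : ℕ) : ℕ → Set where
  ∅    : ∀ {d} → Trie k d
  leaf : Trie k 0
  node : ∀ {d} → Vec (Trie k d) k → Trie k (suc d)

module _ {k : ℕ} where

  children : ∀ {d} → Trie k (suc d) → Vec (Trie k d) k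
  children ∅         = replicate k ∅
  children (node ts) = ts

  data _∈ᵗ_ : ∀ {d} → Vec (Fin k) d → Trie k d → Set where
    leaf  : [] ∈ᵗ leaf
    child : ∀ {d x} {xs : Vec (Fin k) d} {t} → xs ∈ᵗ lookup (children t) x → (x ∷ xs) ∈ᵗ t

  _∈ᵗ?_ : ∀ {d} (xs : Vec (Fin k) d) t → Dec (xs ∈ᵗ t)
  []       ∈ᵗ? ∅    = no λ ()
  []       ∈ᵗ? leaf = yes leaf
  (x ∷ xs) ∈ᵗ? t    = map′ child (λ { (child p) → p }) (xs ∈ᵗ? lookup (children t) x)

  insert : ∀ {d} → Vec (Fin k) d → Trie k d → Trie k d
  insert []       _ = leaf
  insert (x ∷ xs) t = node (updateAt (children t) x (insert xs))

  fromList : ∀ {d} → List (Vec (Fin k) d) → Trie k d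
  fromList = foldr insert ∅

  toList : ∀ {d} → Trie k d → List (Vec (Fin k) d)
  branches : ∀ {d m} → (Fin m → Fin k) → Vec (Trie k d) m → List (Vec (Fin k) (suc d))

  toList ∅         = []
  toList leaf      = [] ∷ []
  toList (node ts) = branches id ts

  branches label []       = []
  branches label (t ∷ ts) = map (label zero ∷_) (toList t) ++ branches (label ∘ suc) ts

  ∈ᵗ-insert : ∀ {d} (xs : Vec (Fin k) d) t → xs ∈ᵗ insert xs t
  ∈ᵗ-insert []       t = leaf
  ∈ᵗ-insert (x ∷ xs) t =
    child (subst (xs ∈ᵗ_) (sym (lookup∘updateAt x (children t))) (∈ᵗ-insert xs _))

  ∈ᵗ-insert-mono : ∀ {d} {xs : Vec (Fin k) d} {t} ys → xs ∈ᵗ t → xs ∈ᵗ insert ys t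
  ∈ᵗ-insert-mono []       leaf = leaf
  ∈ᵗ-insert-mono {xs = x ∷ xs} {t} (y ∷ ys) (child xs∈t) with x Fin.≟ y
  ... | yes refl =
    child (subst (xs ∈ᵗ_) (sym (lookup∘updateAt x (children t))) (∈ᵗ-insert-mono ys xs∈t))
  ... | no x≢y   = child (subst (xs ∈ᵗ_) (sym (lookup∘updateAt′ x y x≢y (children t))) xs∈t)

  ∈ᵗ-fromList : ∀ {d} {xs : Vec (Fin k) d} {xss} → xs ∈ xss → xs ∈ᵗ fromList xss
  ∈ᵗ-fromList {xs = xs} {_ ∷ xss} (here refl)    = ∈ᵗ-insert xs (fromList xss)
  ∈ᵗ-fromList {xss = ys ∷ _}      (there xs∈xss) = ∈ᵗ-insert-mono ys (∈ᵗ-fromList xs∈xss)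

  ∉ᵗ-∅ : ∀ {d} {xs : Vec (Fin k) d} → ¬ xs ∈ᵗ ∅
  ∉ᵗ-∅ {xs = x ∷ _} (child xs∈∅) = ∉ᵗ-∅ (subst (_ ∈ᵗ_) (lookup-replicate x ∅) xs∈∅)

  ∈ᵗ⇒∈toList : ∀ {d} {xs : Vec (Fin k) d} {t} → xs ∈ᵗ t → xs ∈ toList t
  ∈-branches : ∀ {d m} (label : Fin m → Fin k) (ts : Vec (Trie k d) m) i {xs} →
               xs ∈ᵗ lookup ts i → (label i ∷ xs) ∈ branches label ts

  ∈ᵗ⇒∈toList {t = leaf}    leaf         = here refl
  ∈ᵗ⇒∈toList {t = ∅}       x∈∅          = ⊥-elim (∉ᵗ-∅ x∈∅)
  ∈ᵗ⇒∈toList {t = node ts} (child xs∈t) = ∈-branches id ts _ xs∈t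

  ∈-branches label (t ∷ ts) zero    xs∈t = ∈-++⁺ˡ (∈-map⁺ (label zero ∷_) (∈ᵗ⇒∈toList xs∈t))
  ∈-branches label (t ∷ ts) (suc i) xs∈t = ∈-++⁺ʳ _ (∈-branches (label ∘ suc) ts i xs∈t)

-- Total colourings as periodic sequences of symbols

-- The colours of a vertex v_i, of its edge v_i v_{i+1} and of its edge v_i v_{i+3}.
record Symbol (k : ℕ) : Set where
  constructor ⟨_,_,_⟩
  field
    vertex edge₁ edge₃ : Fin k

open Symbol public

-- If s_j is the symbol of v_{i+j}, the colours at v_{i+3}: the vertex itself and its edges
-- to v_{i+4}, v_{i+2}, v_{i+6} and v_i.
star : ∀ {k} → Symbol k → Symbol k → Symbol k → Vec (Fin k) 5
star s₀ s₂ s₃ = vertex s₃ ∷ edge₁ s₃ ∷ edge₁ s₂ ∷ edge₃ s₃ ∷ edge₃ s₀ ∷ []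

record Window {k} (s₀ s₁ s₂ s₃ : Symbol k) : Set where
  constructor window
  field
    vertex₀≢vertex₁ : vertex s₀ ≢ vertex s₁
    vertex₀≢vertex₃ : vertex s₀ ≢ vertex s₃
    star-unique     : Unique (star s₀ s₂ s₃)

record Pattern (n k : ℕ) : Set where
  field
    symbol   : ℕ → Symbol k
    periodic : Periodic n symbol
    windows  : ∀ i → Window (symbol i) (symbol (1 + i)) (symbol (2 + i)) (symbol (3 + i))

five-colours-needed : ∀ {n k} → Pattern n k → 5 ≤ k
five-colours-needed P =
  injective⇒≤ λ {i} {j} → lookup-injective (Window.star-unique (Pattern.windows P 0)) i j

recolour : ∀ {n k l} (π : Fin k → Fin l) → Injective _≡_ _≡_ π → Pattern n k → Pattern n l
recolour π π-inj P = record
  { symbol   = λ i → ⟨ π (vertex (symbol i)) , π (edge₁ (symbol i)) , π (edge₃ (symbol i)) ⟩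
  ; periodic = λ i → cong (λ s → ⟨ π (vertex s) , π (edge₁ s) , π (edge₃ s) ⟩) (periodic i)
  ; windows  = λ i → let window v₀₁ v₀₃ u = windows i in
      window (v₀₁ ∘ π-inj) (v₀₃ ∘ π-inj) (map⁺ π-inj u)
  }
  where open Pattern P

rotate : ∀ {n k} → Pattern n k → ℕ → Pattern n k
rotate P j = record
  { symbol   = λ i → symbol (i + j)
  ; periodic = λ i → trans (cong symbol (+-assoc _ i j)) (periodic (i + j))
  ; windows  = λ i → windows (i + j)
  }
  where open Pattern P

permute : ∀ {n k} → Permutation′ k → Pattern n k → Pattern n k
permute π = recolour (π ⟨$⟩ʳ_) (Injection.injective (↔⇒↣ π))

module FromPattern {m k : ℕ} (P : Pattern (7 + m) k) where

  open Pattern P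

  N : ℕ
  N = 7 + m

  -- The neighbours v + 1, v - 1, v + 3 and v - 3 of a vertex v, with -1 ≡ 6 + m, -3 ≡ 4 + m.
  offsets : Vec ℕ 4
  offsets = 1 ∷ 6 + m ∷ 3 ∷ 4 + m ∷ []

  offset : Fin 4 → ℕ
  offset = lookup offsets

  opposite : Fin 4 → Fin 4
  opposite 0F = 1F
  opposite 1F = 0F
  opposite 2F = 3F
  opposite 3F = 2F

  offset<N : ∀ s → offset s < N
  offset<N 0F = s≤s (s≤s z≤n)
  offset<N 1F = n<1+n (6 + m)
  offset<N 2F = s≤s (s≤s (s≤s (s≤s z≤n)))
  offset<N 3F = s≤s (s≤s (s≤s (s≤s (s≤s (m≤n+m m 2)))))

  offsets-unique : Unique offsets
  offsets-unique =
    ((λ ()) ∷ (λ ()) ∷ (λ ()) ∷ []) ∷ ((λ ()) ∷ (λ ()) ∷ []) ∷ ((λ ()) ∷ []) ∷ [] ∷ []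

  offset+opposite : ∀ s → offset s + offset (opposite s) ≡ N
  offset+opposite 0F = refl
  offset+opposite 1F = cong (6 +_) (+-comm m 1)
  offset+opposite 2F = refl
  offset+opposite 3F = cong (4 +_) (+-comm m 3)

  symbol-% : ∀ i → symbol (i % N) ≡ symbol i
  symbol-% = periodic-% periodic

  symbol-%+ : ∀ i j → symbol (i % N + j) ≡ symbol (i + j)
  symbol-%+ = periodic-%+ periodic

  symbol-+N : ∀ u → symbol (u + N) ≡ symbol u
  symbol-+N u = trans (cong symbol (+-comm u N)) (periodic u)

  wrapˡ : ∀ u {d e} → d + e ≡ N → symbol (d + (u + e)) ≡ symbol u
  wrapˡ u {d} {e} d+e≡N =
    trans (cong symbol (trans (x∙yz≈y∙xz d u e) (cong (u +_) d+e≡N))) (symbol-+N u)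

  wrapʳ : ∀ u {d e} → d + e ≡ N → symbol (u + d + e) ≡ symbol u
  wrapʳ u {d} {e} d+e≡N =
    trans (cong symbol (trans (+-assoc u d e) (cong (u +_) d+e≡N))) (symbol-+N u)

  star-at : ℕ → Vec (Fin k) 5
  star-at u = star (symbol (u + (4 + m))) (symbol (u + (6 + m))) (symbol u)

  star-at-unique : ∀ u → Unique (star-at u)
  star-at-unique u = subst Unique
    (cong₂ (star (symbol (u + (4 + m))))
      (cong symbol (x∙yz≈y∙xz 2 u (4 + m))) (wrapˡ u {3} {4 + m} refl))
    (Window.star-unique (windows (u + (4 + m))))

  edge-colour : ℕ → Fin 4 → Fin k
  edge-colour u s = lookup (star-at u) (suc s)

  Neighbour : Fin N → Fin N → Fin 4 → Set
  Neighbour u v s = toℕ v ≡ (toℕ u + offset s) % N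

  neighbour-unique : ∀ u v s t → Neighbour u v s → Neighbour u v t → s ≡ t
  neighbour-unique u v s t v≡u+s v≡u+t = lookup-injective offsets-unique s t
    ([m+d]%n≡[m+e]%n⇒d≡e (toℕ u) N (offset<N s) (offset<N t) (trans (sym v≡u+s) v≡u+t))

  neighbour-opposite : ∀ u v s → Neighbour u v s → Neighbour v u (opposite s)
  neighbour-opposite u v s v≡u+s = sym (begin
    (toℕ v + s̄) % N              ≡⟨ cong (λ x → (x + s̄) % N) v≡u+s ⟩
    ((U + offset s) % N + s̄) % N  ≡⟨ [m%n+k]%n≡[m+k]%n (U + offset s) s̄ N ⟩
    (U + offset s + s̄) % N       ≡⟨ cong (_% N) (+-assoc U (offset s) s̄) ⟩
    (U + (offset s + s̄)) % N     ≡⟨ cong (λ x → (U + x) % N) (offset+opposite s) ⟩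
    (U + N) % N                  ≡⟨ [m+n]%n≡m%n U N ⟩
    U % N                        ≡⟨ m<n⇒m%n≡m (toℕ<n u) ⟩
    U                            ∎)
    where
    U s̄ : ℕ
    U = toℕ u
    s̄ = offset (opposite s)

  adjacent⇒neighbour : ∀ {u v} → Adj N u v → ∃ (Neighbour u v)
  adjacent⇒neighbour (inj₁ (inj₁ v≡u+1)) = 0F , v≡u+1
  adjacent⇒neighbour (inj₁ (inj₂ v≡u+3)) = 2F , v≡u+3
  adjacent⇒neighbour (inj₂ (inj₁ u≡v+1)) = 1F , neighbour-opposite _ _ 0F u≡v+1
  adjacent⇒neighbour (inj₂ (inj₂ u≡v+3)) = 3F , neighbour-opposite _ _ 2F u≡v+3

  edge-colour-opposite : ∀ u v s → Neighbour u v s →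
                         edge-colour (toℕ v) (opposite s) ≡ edge-colour (toℕ u) s
  edge-colour-opposite u v 0F v≡u+1 = cong edge₁ (trans (cong (λ x → symbol (x + (6 + m))) v≡u+1)
    (trans (symbol-%+ (toℕ u + 1) (6 + m)) (wrapʳ (toℕ u) refl)))
  edge-colour-opposite u v 1F v≡u-1 = cong edge₁ (trans (cong symbol v≡u-1) (symbol-% _))
  edge-colour-opposite u v 2F v≡u+3 = cong edge₃ (trans (cong (λ x → symbol (x + (4 + m))) v≡u+3)
    (trans (symbol-%+ (toℕ u + 3) (4 + m)) (wrapʳ (toℕ u) refl)))
  edge-colour-opposite u v 3F v≡u-3 = cong edge₃ (trans (cong symbol v≡u-3) (symbol-% _))

  vertex-colour-differs : ∀ u s → vertex (symbol u) ≢ vertex (symbol (u + offset s))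
  vertex-colour-differs u 0F = subst (λ x → vertex (symbol u) ≢ vertex (symbol x)) (+-comm 1 u)
    (Window.vertex₀≢vertex₁ (windows u))
  vertex-colour-differs u 2F = subst (λ x → vertex (symbol u) ≢ vertex (symbol x)) (+-comm 3 u)
    (Window.vertex₀≢vertex₃ (windows u))
  vertex-colour-differs u 1F = ≢-sym (subst (λ s → vertex (symbol (u + (6 + m))) ≢ vertex s)
    (wrapˡ u {1} refl) (Window.vertex₀≢vertex₁ (windows (u + (6 + m)))))
  vertex-colour-differs u 3F = ≢-sym (subst (λ s → vertex (symbol (u + (4 + m))) ≢ vertex s)
    (wrapˡ u {3} refl) (Window.vertex₀≢vertex₃ (windows (u + (4 + m)))))

  vcol : Fin N → Fin k
  vcol u = vertex (symbol (toℕ u))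

  ecol : Fin N → Fin N → Fin k
  ecol u v with Fin.any? (λ s → toℕ v ≟ (toℕ u + offset s) % N)
  ... | yes (s , _) = edge-colour (toℕ u) s
  ... | no _        = vcol u   -- u and v are not adjacent: the value is irrelevant

  ecol-neighbour : ∀ u v s → Neighbour u v s → ecol u v ≡ edge-colour (toℕ u) s
  ecol-neighbour u v s v≡u+s with Fin.any? (λ s → toℕ v ≟ (toℕ u + offset s) % N)
  ... | yes (t , v≡u+t) = cong (edge-colour (toℕ u)) (neighbour-unique u v t s v≡u+t v≡u+s)
  ... | no ¬∃ = ⊥-elim (¬∃ (s , v≡u+s))

  star-at-distinct : ∀ u {i j} → i ≢ j → lookup (star-at u) i ≢ lookup (star-at u) j
  star-at-distinct u {i} {j} i≢j = i≢j ∘ lookup-injective (star-at-unique u) i j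

  ecol-sym : ∀ u v → Adj N u v → ecol u v ≡ ecol v u
  ecol-sym u v adj with s , v≡u+s ← adjacent⇒neighbour adj = begin
    ecol u v                          ≡⟨ ecol-neighbour u v s v≡u+s ⟩
    edge-colour (toℕ u) s             ≡⟨ edge-colour-opposite u v s v≡u+s ⟨
    edge-colour (toℕ v) (opposite s)
      ≡⟨ ecol-neighbour v u (opposite s) (neighbour-opposite u v s v≡u+s) ⟨
    ecol v u                          ∎

  vertex-proper : ∀ u v → Adj N u v → vcol u ≢ vcol v
  vertex-proper u v adj with s , v≡u+s ← adjacent⇒neighbour adj = λ eq →
    vertex-colour-differs (toℕ u) s
      (trans eq (cong vertex (trans (cong symbol v≡u+s) (symbol-% _))))

  incidence-proper : ∀ u v → Adj N u v → vcol u ≢ ecol u v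
  incidence-proper u v adj with s , v≡u+s ← adjacent⇒neighbour adj =
    λ eq → star-at-distinct (toℕ u) {0F} {suc s} (λ ()) (trans eq (ecol-neighbour u v s v≡u+s))

  edge-proper : ∀ u v w → Adj N u v → Adj N u w → v ≢ w → ecol u v ≢ ecol u w
  edge-proper u v w adj-v adj-w v≢w
    with s , v≡u+s ← adjacent⇒neighbour adj-v | t , w≡u+t ← adjacent⇒neighbour adj-w | s Fin.≟ t
  ... | yes refl = λ _ → v≢w (toℕ-injective (trans v≡u+s (sym w≡u+t)))
  ... | no s≢t = λ eq → star-at-distinct (toℕ u) (s≢t ∘ Fin.suc-injective)
    (trans (sym (ecol-neighbour u v s v≡u+s)) (trans eq (ecol-neighbour u w t w≡u+t)))

  total-colouring : TotalColouring N k
  total-colouring = record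
    { vcol = vcol ; ecol = ecol ; ecol-sym = ecol-sym ; vertex-proper = vertex-proper
    ; edge-proper = edge-proper ; incidence-proper = incidence-proper }

module FromColouring {m k : ℕ} (T : TotalColouring (7 + m) k) where

  open TotalColouring T

  N : ℕ
  N = 7 + m

  vtx : ℕ → Fin N
  vtx i = i mod N

  toℕ-vtx : ∀ i → toℕ (vtx i) ≡ i % N
  toℕ-vtx i = toℕ-fromℕ< (m%n<n i N)

  vtx-periodic : Periodic N vtx
  vtx-periodic i = toℕ-injective (begin
    toℕ (vtx (N + i))  ≡⟨ toℕ-vtx (N + i) ⟩
    (N + i) % N        ≡⟨ cong (_% N) (+-comm N i) ⟩
    (i + N) % N        ≡⟨ [m+n]%n≡m%n i N ⟩
    i % N              ≡⟨ toℕ-vtx i ⟨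
    toℕ (vtx i)        ∎)

  vtx-shift : ∀ d i → vtx (d + (N + i)) ≡ vtx (d + i)
  vtx-shift d i = trans (cong vtx (x∙yz≈y∙xz d N i)) (vtx-periodic (d + i))

  jump : ∀ d i → toℕ (vtx (d + i)) ≡ (toℕ (vtx i) + d) % N
  jump d i = begin
    toℕ (vtx (d + i))      ≡⟨ toℕ-vtx (d + i) ⟩
    (d + i) % N            ≡⟨ cong (_% N) (+-comm d i) ⟩
    (i + d) % N            ≡⟨ [m%n+k]%n≡[m+k]%n i d N ⟨
    (i % N + d) % N        ≡⟨ cong (λ x → (x + d) % N) (toℕ-vtx i) ⟨
    (toℕ (vtx i) + d) % N  ∎

  vtx-≢ : ∀ i e → 0 < e → {e<7 : True (e <? 7)} → vtx i ≢ vtx (e + i)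
  vtx-≢ i e 0<e {e<7} eq =
    <⇒≢ 0<e ([m+d]%n≡[m+e]%n⇒d≡e i N z<s (≤-trans (toWitness e<7) (m≤m+n 7 m)) (begin
    (i + 0) % N        ≡⟨ cong (_% N) (+-identityʳ i) ⟩
    i % N              ≡⟨ toℕ-vtx i ⟨
    toℕ (vtx i)        ≡⟨ cong toℕ eq ⟩
    toℕ (vtx (e + i))  ≡⟨ toℕ-vtx (e + i) ⟩
    (e + i) % N        ≡⟨ cong (_% N) (+-comm e i) ⟩
    (i + e) % N        ∎))

  adj⁺¹ : ∀ i → Adj N (vtx i) (vtx (1 + i))
  adj⁺¹ i = inj₁ (inj₁ (jump 1 i))

  adj⁺³ : ∀ i → Adj N (vtx i) (vtx (3 + i))
  adj⁺³ i = inj₁ (inj₂ (jump 3 i))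

  adj⁻¹ : ∀ i → Adj N (vtx (1 + i)) (vtx i)
  adj⁻¹ i = inj₂ (inj₁ (jump 1 i))

  adj⁻³ : ∀ i → Adj N (vtx (3 + i)) (vtx i)
  adj⁻³ i = inj₂ (inj₂ (jump 3 i))

  symbol-at : Fin N → Fin N → Fin N → Symbol k
  symbol-at u v w = ⟨ vcol u , ecol u v , ecol u w ⟩

  symbol : ℕ → Symbol k
  symbol i = symbol-at (vtx i) (vtx (1 + i)) (vtx (3 + i))

  symbol-periodic : Periodic N symbol
  symbol-periodic i = cong₂ (λ u vw → symbol-at u (proj₁ vw) (proj₂ vw))
    (vtx-periodic i) (cong₂ _,_ (vtx-shift 1 i) (vtx-shift 3 i))

  star-unique : ∀ i → Unique (star (symbol i) (symbol (2 + i)) (symbol (3 + i)))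
  star-unique i = subst₂ (λ x y → Unique (vcol u ∷ ecol u a ∷ x ∷ ecol u c ∷ y ∷ []))
    (ecol-sym u b (adj⁻¹ (2 + i))) (ecol-sym u d (adj⁻³ i)) around
    where
    u a b c d : Fin N
    u = vtx (3 + i)
    a = vtx (4 + i)
    b = vtx (2 + i)
    c = vtx (6 + i)
    d = vtx i
    u~a = adj⁺¹ (3 + i)
    u~b = adj⁻¹ (2 + i)
    u~c = adj⁺³ (3 + i)
    u~d = adj⁻³ i
    around : Unique (vcol u ∷ ecol u a ∷ ecol u b ∷ ecol u c ∷ ecol u d ∷ [])
    around =
      ( incidence-proper u a u~a ∷ incidence-proper u b u~b
      ∷ incidence-proper u c u~c ∷ incidence-proper u d u~d ∷ [])
      ∷ ( edge-proper u a b u~a u~b (≢-sym (vtx-≢ (2 + i) 2 z<s))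
        ∷ edge-proper u a c u~a u~c (vtx-≢ (4 + i) 2 z<s)
        ∷ edge-proper u a d u~a u~d (≢-sym (vtx-≢ i 4 z<s))
        ∷ [])
      ∷ ( edge-proper u b c u~b u~c (vtx-≢ (2 + i) 4 z<s)
        ∷ edge-proper u b d u~b u~d (≢-sym (vtx-≢ i 2 z<s))
        ∷ [])
      ∷ (edge-proper u c d u~c u~d (≢-sym (vtx-≢ i 6 z<s)) ∷ [])
      ∷ [] ∷ []

  periodic-pattern : Pattern N k
  periodic-pattern = record
    { symbol   = symbol
    ; periodic = symbol-periodic
    ; windows  = λ i →
        window (vertex-proper _ _ (adj⁺¹ i)) (vertex-proper _ _ (adj⁺³ i)) (star-unique i)
    }

-- Closed walks and the upper bounds

window? : ∀ {k} (s₀ s₁ s₂ s₃ : Symbol k) → Dec (Window s₀ s₁ s₂ s₃)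
window? s₀ s₁ s₂ s₃ =
  map′ (λ (p , q , r) → window p q r) (λ (window p q r) → p , q , r)
    (¬? (vertex s₀ Fin.≟ vertex s₁) ×-dec ¬? (vertex s₀ Fin.≟ vertex s₃)
      ×-dec allPairs? (λ x y → ¬? (x Fin.≟ y)) (star s₀ s₂ s₃))

subst-window : ∀ {k} {s₀ s₁ s₂ s₃ t₀ t₁ t₂ t₃ : Symbol k} →
               s₀ ≡ t₀ → s₁ ≡ t₁ → s₂ ≡ t₂ → s₃ ≡ t₃ → Window s₀ s₁ s₂ s₃ → Window t₀ t₁ t₂ t₃
subst-window refl refl refl refl v = v

Triple : ℕ → Set
Triple k = Symbol k × Symbol k × Symbol k

data Walk {k : ℕ} : Triple k → List (Symbol k) → Triple k → Set where
  []  : ∀ {P} → Walk P [] P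
  _∷_ : ∀ {s₀ s₁ s₂ x xs Q} →
        Window s₀ s₁ s₂ x → Walk (s₁ , s₂ , x) xs Q → Walk (s₀ , s₁ , s₂) (x ∷ xs) Q

_++ʷ_ : ∀ {k} {P Q R : Triple k} {xs ys} → Walk P xs Q → Walk Q ys R → Walk P (xs ++ ys) R
[]       ++ʷ ws = ws
(v ∷ vs) ++ʷ ws = v ∷ (vs ++ʷ ws)

final : ∀ {k} → Triple k → List (Symbol k) → Triple k
final P              []       = P
final (s₀ , s₁ , s₂) (x ∷ xs) = final (s₁ , s₂ , x) xs

walk? : ∀ {k} (P : Triple k) xs → Dec (Walk P xs (final P xs))
walk? P              []       = yes []
walk? (s₀ , s₁ , s₂) (x ∷ xs) =
  map′ (uncurry _∷_) (λ { (v ∷ vs) → v , vs }) (window? s₀ s₁ s₂ x ×-dec walk? (s₁ , s₂ , x) xs)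

nth : ∀ {A : Set} → A → List A → ℕ → A
nth d []       _       = d
nth d (x ∷ xs) zero    = x
nth d (x ∷ xs) (suc i) = nth d xs i

nth-++ˡ : ∀ {A : Set} (d : A) xs ys {i} → i < length xs → nth d (xs ++ ys) i ≡ nth d xs i
nth-++ˡ d (x ∷ xs) ys {zero}  _         = refl
nth-++ˡ d (x ∷ xs) ys {suc i} (s≤s i<) = nth-++ˡ d xs ys i<

nth-++ʳ : ∀ {A : Set} (d : A) xs ys i → nth d (xs ++ ys) (length xs + i) ≡ nth d ys i
nth-++ʳ d []       ys i = refl
nth-++ʳ d (x ∷ xs) ys i = nth-++ʳ d xs ys i

walk-window : ∀ {k} (d : Symbol k) {s₀ s₁ s₂ xs Q} → Walk (s₀ , s₁ , s₂) xs Q →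
              ∀ {q} → q < length xs → let at = nth d (s₀ ∷ s₁ ∷ s₂ ∷ xs) in
              Window (at q) (at (1 + q)) (at (2 + q)) (at (3 + q))
walk-window d (v ∷ vs) {zero}  _         = v
walk-window d (v ∷ vs) {suc q} (s≤s q<) = walk-window d vs q<

module FromClosedWalk {k} {P : Triple k} {w : List (Symbol k)}
                      (closed : Walk P w P) (3≤n : 3 ≤ length w) where

  n : ℕ
  n = length w

  instance
    n-nonZero : NonZero n
    n-nonZero = >-nonZero (≤-trans (s≤s z≤n) 3≤n)

  d : Symbol k
  d = proj₁ P

  symbol : ℕ → Symbol k
  symbol i = nth d w (i % n)

  nth-++-self : ∀ {r} → r < n + n → nth d (w ++ w) r ≡ nth d w (r % n)
  nth-++-self {r} r<2n with r <? n
  ... | yes r<n = trans (nth-++ˡ d w w r<n) (cong (nth d w) (sym (m<n⇒m%n≡m r<n)))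
  ... | no r≮n with t , n+t≡r ← m≤n⇒∃[o]m+o≡n (≮⇒≥ r≮n) = begin
    nth d (w ++ w) r        ≡⟨ cong (nth d (w ++ w)) (sym n+t≡r) ⟩
    nth d (w ++ w) (n + t)  ≡⟨ nth-++ʳ d w w t ⟩
    nth d w t               ≡⟨ cong (nth d w) t≡r%n ⟩
    nth d w (r % n)         ∎
    where
    t<n : t < n
    t<n = +-cancelˡ-< n t n (subst (_< n + n) (sym n+t≡r) r<2n)
    t≡r%n : t ≡ r % n
    t≡r%n = begin
      t            ≡⟨ m<n⇒m%n≡m t<n ⟨
      t % n        ≡⟨ [m+n]%n≡m%n t n ⟨
      (t + n) % n  ≡⟨ cong (_% n) (trans (+-comm t n) n+t≡r) ⟩
      r % n        ∎

  symbol-in-twice : ∀ j i → j ≤ 3 → symbol (j + i) ≡ nth d (w ++ w) (j + i % n)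
  symbol-in-twice j i j≤3 = sym (begin
    nth d (w ++ w) (j + i % n)  ≡⟨ nth-++-self (+-mono-≤-< (≤-trans j≤3 3≤n) (m%n<n i n)) ⟩
    nth d w ((j + i % n) % n)   ≡⟨ cong (λ x → nth d w (x % n)) (+-comm j (i % n)) ⟩
    nth d w ((i % n + j) % n)   ≡⟨ cong (nth d w) ([m%n+k]%n≡[m+k]%n i j n) ⟩
    nth d w ((i + j) % n)       ≡⟨ cong (λ x → nth d w (x % n)) (+-comm i j) ⟩
    nth d w ((j + i) % n)       ∎)

  symbol-periodic : Periodic n symbol
  symbol-periodic i = cong (nth d w) (trans (cong (_% n) (+-comm n i)) ([m+n]%n≡m%n i n))

  symbol-windows : ∀ i → Window (symbol i) (symbol (1 + i)) (symbol (2 + i)) (symbol (3 + i))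
  symbol-windows i = subst-window
    (sym (symbol-in-twice 0 i z≤n)) (sym (symbol-in-twice 1 i (s≤s z≤n)))
    (sym (symbol-in-twice 2 i (s≤s (s≤s z≤n)))) (sym (symbol-in-twice 3 i ≤-refl))
    (walk-window d (closed ++ʷ closed) {3 + i % n}
      (subst (3 + i % n <_) (sym (length-++ w)) (+-mono-≤-< 3≤n (m%n<n i n))))

  periodic-pattern : Pattern n k
  periodic-pattern = record
    { symbol = symbol ; periodic = symbol-periodic ; windows = symbol-windows }

Loop : ∀ {k} → Triple k → ℕ → Set
Loop {k} P n = Σ[ w ∈ List (Symbol k) ] Walk P w P × length w ≡ n

loop : ∀ {k} (P : Triple k) w → Walk P w P → Loop P (length w)
loop P w walk = w , walk , refl

_⊕_ : ∀ {k} {P : Triple k} {m n} → Loop P m → Loop P n → Loop P (m + n)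
(w , walk , refl) ⊕ (v , walk′ , refl) = w ++ v , walk ++ʷ walk′ , length-++ w

ClosedWalk : ℕ → ℕ → Set
ClosedWalk k n = Σ[ P ∈ Triple k ] Loop P n

closed-walk⇒total-colouring : ∀ {m k} → ClosedWalk k (7 + m) → TotalColouring (7 + m) k
closed-walk⇒total-colouring {m} {k} (P , w , walk , ∣w∣≡n) = FromPattern.total-colouring
  (subst (λ n → Pattern n k) ∣w∣≡n
    (FromClosedWalk.periodic-pattern walk (subst (3 ≤_) (sym ∣w∣≡n) (s≤s (s≤s (s≤s z≤n))))))

-- Stated for 5 + k colours, so that the same closed walk serves with five and with six.
base : ∀ {k} → Triple (5 + k)
base = ⟨ 0F , 1F , 2F ⟩ , ⟨ 2F , 0F , 3F ⟩ , ⟨ 4F , 1F , 3F ⟩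

block₅ : ∀ {k} → List (Symbol (5 + k))
block₅ =
  ⟨ 3F , 0F , 4F ⟩ ∷ ⟨ 1F , 4F , 2F ⟩ ∷ ⟨ 0F , 1F , 2F ⟩ ∷ ⟨ 2F , 0F , 3F ⟩ ∷ ⟨ 4F , 1F , 3F ⟩ ∷ []

loop₅ : ∀ {k} → Loop {5 + k} base 5
loop₅ = loop base block₅ (from-yes (walk? base block₅))

word₁₄ : List (Symbol 5)
word₁₄ =
  ⟨ 3F , 0F , 4F ⟩ ∷ ⟨ 1F , 4F , 2F ⟩ ∷ ⟨ 0F , 2F , 1F ⟩ ∷ ⟨ 1F , 3F , 0F ⟩ ∷
  ⟨ 0F , 4F , 1F ⟩ ∷ ⟨ 2F , 3F , 0F ⟩ ∷ ⟨ 4F , 2F , 1F ⟩ ∷ ⟨ 3F , 4F , 0F ⟩ ∷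
  ⟨ 1F , 2F , 3F ⟩ ∷ ⟨ 0F , 3F , 4F ⟩ ∷ ⟨ 1F , 4F , 2F ⟩ ∷ ⟨ 0F , 1F , 2F ⟩ ∷
  ⟨ 2F , 0F , 3F ⟩ ∷ ⟨ 4F , 1F , 3F ⟩ ∷ []

word₁₆ : List (Symbol 5)
word₁₆ =
  ⟨ 3F , 0F , 4F ⟩ ∷ ⟨ 4F , 1F , 2F ⟩ ∷ ⟨ 0F , 2F , 4F ⟩ ∷ ⟨ 1F , 3F , 0F ⟩ ∷
  ⟨ 0F , 1F , 4F ⟩ ∷ ⟨ 3F , 2F , 0F ⟩ ∷ ⟨ 4F , 1F , 3F ⟩ ∷ ⟨ 3F , 2F , 0F ⟩ ∷
  ⟨ 1F , 4F , 3F ⟩ ∷ ⟨ 2F , 1F , 0F ⟩ ∷ ⟨ 4F , 2F , 3F ⟩ ∷ ⟨ 0F , 1F , 4F ⟩ ∷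
  ⟨ 3F , 4F , 2F ⟩ ∷ ⟨ 0F , 1F , 2F ⟩ ∷ ⟨ 2F , 0F , 3F ⟩ ∷ ⟨ 4F , 1F , 3F ⟩ ∷ []

word₁₈ : List (Symbol 5)
word₁₈ =
  ⟨ 3F , 0F , 4F ⟩ ∷ ⟨ 4F , 1F , 2F ⟩ ∷ ⟨ 2F , 0F , 4F ⟩ ∷ ⟨ 1F , 3F , 2F ⟩ ∷
  ⟨ 0F , 1F , 4F ⟩ ∷ ⟨ 3F , 0F , 2F ⟩ ∷ ⟨ 4F , 3F , 1F ⟩ ∷ ⟨ 2F , 1F , 0F ⟩ ∷
  ⟨ 0F , 4F , 3F ⟩ ∷ ⟨ 3F , 2F , 0F ⟩ ∷ ⟨ 1F , 4F , 3F ⟩ ∷ ⟨ 2F , 1F , 0F ⟩ ∷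
  ⟨ 4F , 2F , 3F ⟩ ∷ ⟨ 0F , 1F , 4F ⟩ ∷ ⟨ 3F , 4F , 2F ⟩ ∷ ⟨ 0F , 1F , 2F ⟩ ∷
  ⟨ 2F , 0F , 3F ⟩ ∷ ⟨ 4F , 1F , 3F ⟩ ∷ []

word₂₂ : List (Symbol 5)
word₂₂ =
  ⟨ 3F , 0F , 4F ⟩ ∷ ⟨ 1F , 4F , 2F ⟩ ∷ ⟨ 0F , 1F , 2F ⟩ ∷ ⟨ 2F , 0F , 3F ⟩ ∷
  ⟨ 3F , 1F , 4F ⟩ ∷ ⟨ 4F , 0F , 3F ⟩ ∷ ⟨ 1F , 2F , 4F ⟩ ∷ ⟨ 0F , 1F , 3F ⟩ ∷
  ⟨ 2F , 0F , 4F ⟩ ∷ ⟨ 3F , 1F , 2F ⟩ ∷ ⟨ 4F , 2F , 0F ⟩ ∷ ⟨ 3F , 0F , 1F ⟩ ∷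
  ⟨ 1F , 4F , 3F ⟩ ∷ ⟨ 3F , 2F , 1F ⟩ ∷ ⟨ 0F , 4F , 3F ⟩ ∷ ⟨ 2F , 0F , 1F ⟩ ∷
  ⟨ 4F , 2F , 3F ⟩ ∷ ⟨ 1F , 0F , 4F ⟩ ∷ ⟨ 3F , 4F , 2F ⟩ ∷ ⟨ 0F , 1F , 2F ⟩ ∷
  ⟨ 2F , 0F , 3F ⟩ ∷ ⟨ 4F , 1F , 3F ⟩ ∷ []

loop₁₄ : Loop {5} base 14
loop₁₄ = loop base word₁₄ (from-yes (walk? base word₁₄))

loop₁₆ : Loop {5} base 16
loop₁₆ = loop base word₁₆ (from-yes (walk? base word₁₆))

loop₁₈ : Loop {5} base 18
loop₁₈ = loop base word₁₈ (from-yes (walk? base word₁₈))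

loop₂₂ : Loop {5} base 22
loop₂₂ = loop base word₂₂ (from-yes (walk? base word₂₂))

loop-from-18 : ∀ i → Loop {5} base (18 + i)
loop-from-18 0 = loop₁₈
loop-from-18 1 = loop₅ ⊕ loop₁₄
loop-from-18 2 = loop₅ ⊕ (loop₅ ⊕ (loop₅ ⊕ loop₅))
loop-from-18 3 = loop₅ ⊕ loop₁₆
loop-from-18 4 = loop₂₂
loop-from-18 (suc (suc (suc (suc (suc i))))) = loop₅ ⊕ loop-from-18 i

base′ : Triple 5
base′ = ⟨ 0F , 3F , 2F ⟩ , ⟨ 1F , 4F , 0F ⟩ , ⟨ 0F , 1F , 2F ⟩

word₉ : List (Symbol 5)
word₉ =
  ⟨ 3F , 4F , 0F ⟩ ∷ ⟨ 2F , 1F , 3F ⟩ ∷ ⟨ 4F , 3F , 0F ⟩ ∷ ⟨ 2F , 1F , 4F ⟩ ∷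
  ⟨ 0F , 4F , 2F ⟩ ∷ ⟨ 2F , 1F , 3F ⟩ ∷ ⟨ 0F , 3F , 2F ⟩ ∷ ⟨ 1F , 4F , 0F ⟩ ∷
  ⟨ 0F , 1F , 2F ⟩ ∷ []

word₁₁ : List (Symbol 5)
word₁₁ =
  ⟨ 3F , 4F , 0F ⟩ ∷ ⟨ 2F , 3F , 1F ⟩ ∷ ⟨ 1F , 4F , 0F ⟩ ∷ ⟨ 2F , 3F , 1F ⟩ ∷
  ⟨ 0F , 4F , 2F ⟩ ∷ ⟨ 2F , 3F , 1F ⟩ ∷ ⟨ 4F , 0F , 2F ⟩ ∷ ⟨ 1F , 4F , 3F ⟩ ∷
  ⟨ 0F , 3F , 2F ⟩ ∷ ⟨ 1F , 4F , 0F ⟩ ∷ ⟨ 0F , 1F , 2F ⟩ ∷ []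

loop₉ : Loop base′ 9
loop₉ = loop base′ word₉ (from-yes (walk? base′ word₉))

loop₁₁ : Loop base′ 11
loop₁₁ = loop base′ word₁₁ (from-yes (walk? base′ word₁₁))

five-colour-closed-walk : ∀ m → ¬ Exceptional (7 + m) → ClosedWalk 5 (7 + m)
five-colour-closed-walk 0  ¬exc = ⊥-elim (¬exc (inj₁ refl))
five-colour-closed-walk 1  ¬exc = ⊥-elim (¬exc (inj₂ (inj₁ refl)))
five-colour-closed-walk 2  _    = base′ , loop₉
five-colour-closed-walk 3  _    = base , loop₅ ⊕ loop₅
five-colour-closed-walk 4  _    = base′ , loop₁₁
five-colour-closed-walk 5  ¬exc = ⊥-elim (¬exc (inj₂ (inj₂ (inj₁ refl))))
five-colour-closed-walk 6  ¬exc = ⊥-elim (¬exc (inj₂ (inj₂ (inj₂ (inj₁ refl)))))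
five-colour-closed-walk 7  _    = base , loop₁₄
five-colour-closed-walk 8  _    = base , loop₅ ⊕ (loop₅ ⊕ loop₅)
five-colour-closed-walk 9  _    = base , loop₁₆
five-colour-closed-walk 10 ¬exc = ⊥-elim (¬exc (inj₂ (inj₂ (inj₂ (inj₂ refl)))))
five-colour-closed-walk (suc (suc (suc (suc (suc (suc (suc (suc (suc (suc (suc i))))))))))) _ =
  base , loop-from-18 i

word₇ : List (Symbol 6)
word₇ =
  ⟨ 3F , 0F , 4F ⟩ ∷ ⟨ 1F , 2F , 4F ⟩ ∷ ⟨ 0F , 1F , 4F ⟩ ∷ ⟨ 2F , 3F , 5F ⟩ ∷
  ⟨ 0F , 1F , 2F ⟩ ∷ ⟨ 2F , 0F , 3F ⟩ ∷ ⟨ 4F , 1F , 3F ⟩ ∷ []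

word₈ : List (Symbol 6)
word₈ =
  ⟨ 3F , 0F , 4F ⟩ ∷ ⟨ 5F , 4F , 1F ⟩ ∷ ⟨ 1F , 2F , 5F ⟩ ∷ ⟨ 0F , 3F , 5F ⟩ ∷
  ⟨ 2F , 4F , 5F ⟩ ∷ ⟨ 0F , 1F , 2F ⟩ ∷ ⟨ 2F , 0F , 3F ⟩ ∷ ⟨ 4F , 1F , 3F ⟩ ∷ []

loop₇ : Loop {6} base 7
loop₇ = loop base word₇ (from-yes (walk? base word₇))

loop₈ : Loop {6} base 8
loop₈ = loop base word₈ (from-yes (walk? base word₈))

six-colour-closed-walk : ∀ {n} → Exceptional n → ClosedWalk 6 n
six-colour-closed-walk (inj₁ refl)                          = base , loop₇
six-colour-closed-walk (inj₂ (inj₁ refl))                   = base , loop₈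
six-colour-closed-walk (inj₂ (inj₂ (inj₁ refl)))            = base , loop₇ ⊕ loop₅
six-colour-closed-walk (inj₂ (inj₂ (inj₂ (inj₁ refl))))     = base , loop₈ ⊕ loop₅
six-colour-closed-walk (inj₂ (inj₂ (inj₂ (inj₂ refl))))     = base , loop₇ ⊕ (loop₅ ⊕ loop₅)

-- The lower bound for n ∈ {7, 8, 12, 13, 17}

State : Set
State = Vec (Fin 5) 7

snapshot : Symbol 5 → Symbol 5 → Symbol 5 → State
snapshot s₀ s₁ s₂ =
  vertex s₀ ∷ vertex s₁ ∷ vertex s₂ ∷ edge₃ s₀ ∷ edge₃ s₁ ∷ edge₃ s₂ ∷ edge₁ s₂ ∷ []

-- What later windows still need from the symbols j + 3, j + 4, j + 5. The offset 3 makes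
-- every constraint between coordinates of a state come from a window at an index ≥ j.
state : (ℕ → Symbol 5) → ℕ → State
state σ j = snapshot (σ (3 + j)) (σ (4 + j)) (σ (5 + j))

fresh? : ∀ {k m} (cs : Vec (Fin k) m) x → Dec (All (x ≢_) cs)
fresh? cs x = all? (λ c → ¬? (x Fin.≟ c)) cs

avoiding : ∀ {k m} → Vec (Fin k) m → List (Fin k)
avoiding cs = filter (fresh? cs) (allFin _)

∈-avoiding : ∀ {k m} {x : Fin k} {cs : Vec (Fin k) m} → All (x ≢_) cs → x ∈ avoiding cs
∈-avoiding {x = x} {cs} = ∈-filter⁺ (fresh? cs) (∈-allFin x)

Valid : State → Set
Valid (c₀ ∷ c₁ ∷ c₂ ∷ t₀ ∷ t₁ ∷ t₂ ∷ e ∷ []) =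
  c₀ ≢ c₁ × c₁ ≢ c₂ × c₂ ≢ e × c₂ ≢ t₂ × e ≢ t₂ × e ≢ t₀ × c₁ ≢ t₁ × c₀ ≢ t₀

valid? : Decidable Valid
valid? (c₀ ∷ c₁ ∷ c₂ ∷ t₀ ∷ t₁ ∷ t₂ ∷ e ∷ []) =
  c₀ ≢? c₁ ×-dec c₁ ≢? c₂ ×-dec c₂ ≢? e ×-dec c₂ ≢? t₂ ×-dec
  e ≢? t₂ ×-dec e ≢? t₀ ×-dec c₁ ≢? t₁ ×-dec c₀ ≢? t₀
  where
  _≢?_ : (x y : Fin 5) → Dec (x ≢ y)
  x ≢? y = ¬? (x Fin.≟ y)

-- The next symbol ⟨ x , y , z ⟩ avoids every colour of the state that a window compares it with.
successors : State → List State
successors (c₀ ∷ c₁ ∷ c₂ ∷ t₀ ∷ t₁ ∷ t₂ ∷ e ∷ []) =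
  concatMap (λ x →
    concatMap (λ y →
      map (λ z → c₁ ∷ c₂ ∷ x ∷ t₁ ∷ t₂ ∷ z ∷ y ∷ [])
        (avoiding (e ∷ t₀ ∷ x ∷ y ∷ [])))
      (avoiding (e ∷ t₀ ∷ x ∷ t₁ ∷ [])))
    (avoiding (e ∷ t₀ ∷ c₀ ∷ c₂ ∷ []))

predecessors : State → List State
predecessors (c₁ ∷ c₂ ∷ x ∷ t₁ ∷ t₂ ∷ z ∷ y ∷ []) =
  concatMap (λ c₀ →
    concatMap (λ t₀ →
      filter valid? (map (λ e → c₀ ∷ c₁ ∷ c₂ ∷ t₀ ∷ t₁ ∷ t₂ ∷ e ∷ [])
        (avoiding (x ∷ y ∷ z ∷ t₀ ∷ []))))
      (avoiding (x ∷ y ∷ z ∷ [])))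
    (avoiding (x ∷ []))

module _ {n : ℕ} (P : Pattern n 5) where

  open Pattern P

  private
    σ : ℕ → Symbol 5
    σ = symbol

    at : ℕ → Fin 5 → Fin 5
    at i = lookup (star (σ i) (σ (2 + i)) (σ (3 + i)))

    apart : ∀ i (p q : Fin 5) {p≢q : False (p Fin.≟ q)} → at i p ≢ at i q
    apart i p q {p≢q} = toWitnessFalse p≢q ∘ lookup-injective (Window.star-unique (windows i)) p q

    step : ∀ i → vertex (σ i) ≢ vertex (σ (1 + i))
    step i = Window.vertex₀≢vertex₁ (windows i)

    jump : ∀ i → vertex (σ i) ≢ vertex (σ (3 + i))
    jump i = Window.vertex₀≢vertex₃ (windows i)

  state-valid : ∀ j → Valid (state σ j)
  state-valid j = step (3 + j) , step (4 + j)
                , apart (2 + j) 0F 1F , apart (2 + j) 0F 3F , apart (2 + j) 1F 3F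
                , apart (3 + j) 2F 4F , apart (1 + j) 0F 3F , apart j 0F 3F

  state-successor : ∀ j → state σ (suc j) ∈ successors (state σ j)
  state-successor j =
    ∈-concatMap⁺ _ (lose (∈-avoiding x∉)
      (∈-concatMap⁺ _ (lose (∈-avoiding y∉)
        (∈-map⁺ _ (∈-avoiding z∉)))))
    where
    x∉ = apart (3 + j) 0F 2F ∷ apart (3 + j) 0F 4F ∷ ≢-sym (jump (3 + j)) ∷ ≢-sym (step (5 + j))
       ∷ []
    y∉ = apart (3 + j) 1F 2F ∷ apart (3 + j) 1F 4F ∷ apart (3 + j) 1F 0F ∷ apart (4 + j) 2F 4F ∷ []
    z∉ = apart (3 + j) 3F 2F ∷ apart (3 + j) 3F 4F ∷ apart (3 + j) 3F 0F ∷ apart (3 + j) 3F 1F ∷ []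

  state-predecessor : ∀ j → state σ j ∈ predecessors (state σ (suc j))
  state-predecessor j =
    ∈-concatMap⁺ _ (lose (∈-avoiding (jump (3 + j) ∷ []))
      (∈-concatMap⁺ _ (lose (∈-avoiding t₀∉)
        (∈-filter⁺ valid? (∈-map⁺ _ (∈-avoiding e∉)) (state-valid j)))))
    where
    t₀∉ = apart (3 + j) 4F 0F ∷ apart (3 + j) 4F 1F ∷ apart (3 + j) 4F 3F ∷ []
    e∉ = apart (3 + j) 2F 0F ∷ apart (3 + j) 2F 1F ∷ apart (3 + j) 2F 3F ∷ apart (3 + j) 2F 4F ∷ []

equalities-with : ∀ {k m} → Fin k → Vec (Fin k) m → List Bool
equalities-with x []       = []
equalities-with x (y ∷ ys) = does (x Fin.≟ y) ∷ equalities-with x ys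

equalities : ∀ {k m} → Vec (Fin k) m → List Bool
equalities []       = []
equalities (x ∷ xs) = equalities-with x xs ++ equalities xs

module _ {k l} {π : Fin k → Fin l} (π-inj : Injective _≡_ _≡_ π) where

  does-≟-injective : ∀ x y → does (π x Fin.≟ π y) ≡ does (x Fin.≟ y)
  does-≟-injective x y with x Fin.≟ y
  ... | yes refl = dec-true (π x Fin.≟ π x) refl
  ... | no x≢y   = dec-false (π x Fin.≟ π y) (x≢y ∘ π-inj)

  equalities-with-injective : ∀ {m} x (ys : Vec (Fin k) m) →
                              equalities-with (π x) (Vec.map π ys) ≡ equalities-with x ys
  equalities-with-injective x []       = refl
  equalities-with-injective x (y ∷ ys) =
    cong₂ _∷_ (does-≟-injective x y) (equalities-with-injective x ys)

  equalities-injective : ∀ {m} (xs : Vec (Fin k) m) → equalities (Vec.map π xs) ≡ equalities xs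
  equalities-injective []       = refl
  equalities-injective (x ∷ xs) =
    cong₂ _++_ (equalities-with-injective x xs) (equalities-injective xs)

-- S consists of the states whose coordinates coincide exactly where those of one of these do,
-- so it is closed under recolouring.
representatives : List State
representatives =
  (0F ∷ 1F ∷ 2F ∷ 2F ∷ 0F ∷ 1F ∷ 3F ∷ []) ∷
  (0F ∷ 1F ∷ 2F ∷ 2F ∷ 0F ∷ 3F ∷ 1F ∷ []) ∷
  (0F ∷ 1F ∷ 2F ∷ 2F ∷ 2F ∷ 1F ∷ 3F ∷ []) ∷
  (0F ∷ 1F ∷ 2F ∷ 2F ∷ 2F ∷ 3F ∷ 1F ∷ []) ∷
  (0F ∷ 1F ∷ 2F ∷ 3F ∷ 0F ∷ 1F ∷ 0F ∷ []) ∷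
  (0F ∷ 1F ∷ 2F ∷ 3F ∷ 0F ∷ 3F ∷ 1F ∷ []) ∷ []

S-patterns : List (List Bool)
S-patterns = map equalities representatives

InS : State → Set
InS s = equalities s ∈ S-patterns

inS? : Decidable InS
inS? s = any? (List.≡-dec Bool._≟_ (equalities s)) S-patterns

InS-permute : ∀ (π : Permutation′ 5) {s} → InS s → InS (Vec.map (π ⟨$⟩ʳ_) s)
InS-permute π {s} = subst (_∈ _) (sym (equalities-injective (Injection.injective (↔⇒↣ π)) s))

Normalised : ∀ {n} → Pattern n 5 → Set
Normalised P = vertex s ≡ 0F × edge₁ s ≡ 1F × edge₃ s ≡ 3F
  where s = Pattern.symbol P 5

normalise : ∀ {n} (P : Pattern n 5) → ∃ λ π → Normalised (permute π P)
normalise P =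
  let π , π-maps = permutation-mapping (vertex s ∷ edge₁ s ∷ edge₃ s ∷ []) (0F ∷ 1F ∷ 3F ∷ [])
                     distinct targets
  in π , π-maps 0F , π-maps 1F , π-maps 2F
  where
  s : Symbol 5
  s = Pattern.symbol P 5
  distinct : Unique (vertex s ∷ edge₁ s ∷ edge₃ s ∷ [])
  distinct with (d₀₁ ∷ _ ∷ d₀₃ ∷ _ ∷ []) ∷ (_ ∷ d₁₃ ∷ _ ∷ []) ∷ _
              ← Window.star-unique (Pattern.windows P 2) = (d₀₁ ∷ d₀₃ ∷ []) ∷ (d₁₃ ∷ []) ∷ [] ∷ []
  targets : Unique (0F ∷ 1F ∷ 3F ∷ [])
  targets = ((λ ()) ∷ (λ ()) ∷ []) ∷ ((λ ()) ∷ []) ∷ [] ∷ []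

StateSet : Set
StateSet = Trie 5 7

expand : ∀ {p} {Q : Pred State p} → Decidable Q → (State → List State) → StateSet → StateSet
expand Q? next t = fromList (filter Q? (concatMap next (toList t)))

expand-complete : ∀ {p} {Q : Pred State p} (Q? : Decidable Q) next {t x y} →
                  x ∈ᵗ t → y ∈ next x → Q y → y ∈ᵗ expand Q? next t
expand-complete Q? next x∈t y∈next Qy =
  ∈ᵗ-fromList (∈-filter⁺ Q? (∈-concatMap⁺ next (lose (∈ᵗ⇒∈toList x∈t) y∈next)) Qy)

iterate : ℕ → (StateSet → StateSet) → StateSet → StateSet
iterate zero    f t = t
iterate (suc j) f t = f (iterate j f t)

forward backward : ℕ → State → StateSet
forward  j s = iterate j (expand U? successors) (insert s ∅)
backward j s = iterate j (expand U? predecessors) (insert s ∅)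

vectors : ∀ k m → List (Vec (Fin k) m)
vectors k zero    = [] ∷ []
vectors k (suc m) = concatMap (λ x → map (x ∷_) (vectors k m)) (allFin k)

∈-vectors : ∀ {k m} (xs : Vec (Fin k) m) → xs ∈ vectors k m
∈-vectors []       = here refl
∈-vectors {k} {suc m} (x ∷ xs) = ∈-concatMap⁺ (λ x → map (x ∷_) (vectors k m))
  (lose (∈-allFin x) (∈-map⁺ (x ∷_) (∈-vectors xs)))

normalised-state : Vec (Fin 5) 4 → State
normalised-state (c₀ ∷ c₁ ∷ t₀ ∷ t₁ ∷ []) = c₀ ∷ c₁ ∷ 0F ∷ t₀ ∷ t₁ ∷ 3F ∷ 1F ∷ []

normalised : List State
normalised = map normalised-state (vectors 5 4)

start? : Decidable (λ s → Valid s × InS s)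
start? s = valid? s ×-dec inS? s

outside? : Decidable (λ s → Valid s × ¬ InS s)
outside? s = valid? s ×-dec ¬? (inS? s)

starts : List State
starts = filter start? normalised

survivors : ℕ → StateSet
survivors j = iterate j (expand (¬? ∘ inS?) successors) (fromList (filter outside? normalised))

Disjoint : StateSet → StateSet → Set
Disjoint A B = ListAll.All (λ x → ¬ x ∈ᵗ B) (toList A)

disjoint? : ∀ A B → Dec (Disjoint A B)
disjoint? A B = ListAll.all? (λ x → ¬? (x ∈ᵗ? B)) (toList A)

-- No closed walk of length f + b passes through s.
Separated : ℕ → ℕ → State → Set
Separated f b s = Disjoint (forward f s) (backward b s)

separated? : ∀ f b → Decidable (Separated f b)
separated? f b s = disjoint? (forward f s) (backward b s)

survivors-die-out : toList (survivors 15) ≡ []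
survivors-die-out = refl


disjoint-sound : ∀ {A B x} → Disjoint A B → x ∈ᵗ A → ¬ x ∈ᵗ B
disjoint-sound A∩B=∅ x∈A = ListAll.lookup A∩B=∅ (∈ᵗ⇒∈toList x∈A)

∈-normalised : ∀ {c₀ c₁ c₂ t₀ t₁ t₂ e} → c₂ ≡ 0F → e ≡ 1F → t₂ ≡ 3F →
               (c₀ ∷ c₁ ∷ c₂ ∷ t₀ ∷ t₁ ∷ t₂ ∷ e ∷ []) ∈ normalised
∈-normalised refl refl refl = ∈-map⁺ normalised-state (∈-vectors _)

module _ {n : ℕ} (P : Pattern n 5) where

  open Pattern P

  private
    σ : ℕ → Symbol 5
    σ = symbol

  state-periodic : state σ n ≡ state σ 0
  state-periodic = cong₂ (λ s₀ s₁₂ → snapshot s₀ (proj₁ s₁₂) (proj₂ s₁₂))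
    (shift 3) (cong₂ _,_ (shift 4) (shift 5))
    where
    shift : ∀ d → σ (d + n) ≡ σ d
    shift d = trans (cong σ (+-comm d n)) (periodic d)

  state-normalised : Normalised P → state σ 0 ∈ normalised
  state-normalised (v≡0 , e₁≡1 , e₃≡3) = ∈-normalised v≡0 e₁≡1 e₃≡3

  reaches-forward : ∀ j → state σ j ∈ᵗ forward j (state σ 0)
  reaches-forward zero    = ∈ᵗ-insert (state σ 0) ∅
  reaches-forward (suc j) =
    expand-complete U? successors (reaches-forward j) (state-successor P j) tt

  reaches-backward : ∀ b i → i + b ≡ n → state σ i ∈ᵗ backward b (state σ 0)
  reaches-backward zero    i i+0≡n = subst (_∈ᵗ insert (state σ 0) ∅)
    (sym (trans (cong (state σ) (trans (sym (+-identityʳ i)) i+0≡n)) state-periodic))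
    (∈ᵗ-insert (state σ 0) ∅)
  reaches-backward (suc b) i i+1+b≡n = expand-complete U? predecessors
    (reaches-backward b (suc i) (trans (sym (+-suc i b)) i+1+b≡n)) (state-predecessor P i) tt

  separated⇒¬InS : ∀ f b → ListAll.All (Separated f b) starts → f + b ≡ n →
                   Normalised P → ¬ InS (state σ 0)
  separated⇒¬InS f b separated f+b≡n norm s₀∈S = disjoint-sound
    (ListAll.lookup separated (∈-filter⁺ start? (state-normalised norm) (state-valid P 0 , s₀∈S)))
    (reaches-forward f) (reaches-backward b f f+b≡n)

  VisitsS : Set
  VisitsS = ∃ λ i → InS (state σ i)

  visits-S-or-survives : Normalised P → ∀ j → VisitsS ⊎ state σ j ∈ᵗ survivors j
  visits-S-or-survives norm zero = start (inS? (state σ 0))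
    where
    start : Dec (InS (state σ 0)) → VisitsS ⊎ state σ 0 ∈ᵗ survivors 0
    start (yes s∈S) = inj₁ (0 , s∈S)
    start (no  s∉S) =
      inj₂ (∈ᵗ-fromList (∈-filter⁺ outside? (state-normalised norm) (state-valid P 0 , s∉S)))
  visits-S-or-survives norm (suc j) =
    extend (inS? (state σ (suc j))) (visits-S-or-survives norm j)
    where
    extend : Dec (InS (state σ (suc j))) → VisitsS ⊎ state σ j ∈ᵗ survivors j →
             VisitsS ⊎ state σ (suc j) ∈ᵗ survivors (suc j)
    extend _         (inj₁ visits) = inj₁ visits
    extend (yes s∈S) (inj₂ _)      = inj₁ (suc j , s∈S)
    extend (no  s∉S) (inj₂ s∈)     =
      inj₂ (expand-complete (¬? ∘ inS?) successors s∈ (state-successor P j) s∉S)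

  visits-S : Normalised P → VisitsS
  visits-S norm = [ id , dies ]′ (visits-S-or-survives norm 15)
    where
    dies : state σ 15 ∈ᵗ survivors 15 → VisitsS
    dies s∈ = ⊥-elim (¬Any[] (subst (state σ 15 ∈_) survivors-die-out (∈ᵗ⇒∈toList s∈)))

-- Normalise the colours, walk until S is met, restart the pattern there and normalise again.
no-five-colour-pattern : ∀ {n} f b → ListAll.All (Separated f b) starts → f + b ≡ n → ¬ Pattern n 5
no-five-colour-pattern f b separated f+b≡n P =
  let π , π-norm = normalise P
      Q = permute π P
      j , Qj∈S = visits-S Q π-norm
      ρ , ρ-norm = normalise (rotate Q j)
  in separated⇒¬InS (permute ρ (rotate Q j)) f b separated f+b≡n ρ-norm
       (InS-permute ρ {state (Pattern.symbol Q) j} Qj∈S)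

separated₇ : ListAll.All (Separated 4 3) starts
separated₇ = from-yes (ListAll.all? (separated? 4 3) starts)

separated₈ : ListAll.All (Separated 5 3) starts
separated₈ = from-yes (ListAll.all? (separated? 5 3) starts)

separated₁₂ : ListAll.All (Separated 7 5) starts
separated₁₂ = from-yes (ListAll.all? (separated? 7 5) starts)

separated₁₃ : ListAll.All (Separated 7 6) starts
separated₁₃ = from-yes (ListAll.all? (separated? 7 6) starts)

separated₁₇ : ListAll.All (Separated 9 8) starts
separated₁₇ = from-yes (ListAll.all? (separated? 9 8) starts)

exceptional⇒¬five-colour-pattern : ∀ {n} → Exceptional n → ¬ Pattern n 5
exceptional⇒¬five-colour-pattern (inj₁ refl) =
  no-five-colour-pattern 4 3 separated₇ refl
exceptional⇒¬five-colour-pattern (inj₂ (inj₁ refl)) =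
  no-five-colour-pattern 5 3 separated₈ refl
exceptional⇒¬five-colour-pattern (inj₂ (inj₂ (inj₁ refl))) =
  no-five-colour-pattern 7 5 separated₁₂ refl
exceptional⇒¬five-colour-pattern (inj₂ (inj₂ (inj₂ (inj₁ refl)))) =
  no-five-colour-pattern 7 6 separated₁₃ refl
exceptional⇒¬five-colour-pattern (inj₂ (inj₂ (inj₂ (inj₂ refl)))) =
  no-five-colour-pattern 9 8 separated₁₇ refl

six-colours-needed : ∀ {m} → Exceptional (7 + m) → ∀ k → TotalColouring (7 + m) k → 6 ≤ k
six-colours-needed exc k T with m≤n⇒m<n∨m≡n (five-colours-needed (FromColouring.periodic-pattern T))
... | inj₁ 5<k  = 5<k
... | inj₂ refl = ⊥-elim (exceptional⇒¬five-colour-pattern exc (FromColouring.periodic-pattern T))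

theorem1 : (n : ℕ) → 7 ≤ n →
    (Exceptional n → TotalChromaticNumber n 6) ×
    (¬ Exceptional n → TotalChromaticNumber n 5)
theorem1 n 7≤n with m , refl ← m≤n⇒∃[o]m+o≡n 7≤n =
    (λ exc → closed-walk⇒total-colouring (six-colour-closed-walk exc) , six-colours-needed exc)
  , (λ ¬exc → closed-walk⇒total-colouring (five-colour-closed-walk m ¬exc)
            , λ k T → five-colours-needed (FromColouring.periodic-pattern T))
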